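{- Let $\Gamma$ be a connected $3$-valent plane graph all of whose faces are $4$-gons or $6$-gons, and let $\phi$ be an isometric embedding of $\Gamma$ into a hypercube $H_m$, realized as the graph of all subsets of a set $\Omega$. Label each edge $\alpha\beta$ of $\Gamma$ by the unique element of $\phi(\alpha)\triangle\phi(\beta)$. Then on the boundary of every $6$-gonal face, opposite edges carry the same label, and the three labels occurring on it are pairwise distinct (so the labels around the face read $a,b,c,a,b,c$ with $a,b,c$ pairwise distinct).
   Context: Vertices of $H_m$ are subsets of $\Omega$; $A,B$ adjacent iff $|A\triangle B|=1$; distance is $|A\triangle B|$. An isometric embedding preserves distances, with $\Gamma$ carrying its path distance. -}

module Defs where

open import Data.Nat using (ℕ; zero; suc; _+_; _*_; _≤_)
open import Data.Fin using (Fin; zero; suc)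
open import Data.Fin.Subset using (Subset; ∣_∣; _∈_)
open import Data.Bool using (_xor_)
open import Data.Vec using (zipWith)
open import Data.Product using (_×_; _,_; proj₁; ∃)
open import Data.List using (List; length)
open import Data.List.Relation.Unary.Any using (Any)
open import Data.List.Relation.Unary.AllPairs using (AllPairs)
open import Relation.Binary.PropositionalEquality using (_≡_; _≢_)
open import Relation.Nullary using (¬_)

next3 : Fin 3 → Fin 3
next3 zero = suc zero
next3 (suc zero) = suc (suc zero)
next3 (suc (suc zero)) = zero

-- Vertices are Fin V; the darts (half-edges) at v are (v , i), i : Fin 3,
-- in the cyclic order of the embedding around v. rev pairs each dart with
-- the opposite dart of the same edge.
Dart : ℕ → Set
Dart V = Fin V × Fin 3

record CubicMap (V : ℕ) : Set where
  field
    rev     : Dart V → Dart V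
    rev-inv : ∀ d → rev (rev d) ≡ d

module _ {V : ℕ} (G : CubicMap V) where
  open CubicMap G

  tail : Dart V → Fin V
  tail d = proj₁ d

  head : Dart V → Fin V
  head d = proj₁ (rev d)

  faceStep : Dart V → Dart V
  faceStep d with rev d
  ... | (w , j) = (w , next3 j)

  faceStep^ : ℕ → Dart V → Dart V
  faceStep^ zero d = d
  faceStep^ (suc k) d = faceStep (faceStep^ k d)

  FaceSize : Dart V → ℕ → Set
  FaceSize d k = (faceStep^ k d ≡ d) × (∀ j → 1 ≤ j → suc j ≤ k → faceStep^ j d ≢ d)

  SameFace : Dart V → Dart V → Set
  SameFace d e = ∃ λ k → faceStep^ k d ≡ e

  Simple : Set
  Simple = (∀ d → head d ≢ tail d)
         × (∀ v i j → head (v , i) ≡ head (v , j) → i ≡ j)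

  data Walk : Fin V → Fin V → ℕ → Set where
    nil  : ∀ {v} → Walk v v 0
    step : ∀ {v w n} (i : Fin 3) → Walk (head (v , i)) w n → Walk v w (suc n)

  Connected : Set
  Connected = ∀ u w → ∃ λ n → Walk u w n

  IsDist : Fin V → Fin V → ℕ → Set
  IsDist u w n = Walk u w n × (∀ k → Walk u w k → n ≤ k)

  -- Plane: the map has genus 0, i.e. Euler's formula V - E + F = 2,
  -- with E = 3V/2 and F = number of face orbits (counted via a list of
  -- representatives, one per face).
  Plane : Set
  Plane = ∃ λ (R : List (Dart V)) →
            AllPairs (λ x y → ¬ SameFace x y) R
          × (∀ d → Any (SameFace d) R)
          × (2 * (V + length R) ≡ 4 + 3 * V)

_△_ : ∀ {m} → Subset m → Subset m → Subset m
p △ q = zipWith _xor_ p q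

IsometricEmbedding : ∀ {V} → CubicMap V → ∀ m → (Fin V → Subset m) → Set
IsometricEmbedding {V} G m φ = ∀ u w n → IsDist G u w n → ∣ φ u △ φ w ∣ ≡ n

Label : ∀ {V m} (G : CubicMap V) → (Fin V → Subset m) → Dart V → Fin m → Set
Label G φ d a = a ∈ (φ (tail G d) △ φ (head G d))

{-# OPTIONS --safe #-}
-- The label of an edge is the single coordinate in which the images of its ends differ,
-- so around a face every label occurs an even number of times, and consecutive labels
-- differ, since otherwise the isometry would make the face boundary backtrack. If moreover
-- wₖ ≠ wₖ₊₂ around a hexagon w₀ … w₅, the letter w₀ would occur only once unless w₃ = w₀,
-- which gives the pattern a b c a b c.
-- A hexagon with w₀ = w₂ cannot exist: its vertices v₀ and v₃ differ in the single
-- coordinate w₁, so the isometry joins them by a chord, and the chord forces the faces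
-- across the edges at v₀ to be hexagons of the same kind. Spreading this along the
-- connected graph, every face would be a hexagon, i.e. 6F ≤ 3V, whereas Euler's formula
-- gives 2F = V + 4.
module Submission where

open import Defs
open import Data.Bool using (Bool; true; false; _xor_)
open import Data.Bool.Properties using (xor-assoc; xor-comm; xor-same; xor-identityʳ)
open import Data.Empty using (⊥)
open import Data.Fin using (Fin; zero; suc; toℕ; _≟_) renaming (_<_ to _<ᶠ_)
open import Data.Fin.Patterns using (0F; 1F; 2F; 3F; 4F; 5F)
import Data.Fin.Properties as Finₚ
open import Data.Fin.Subset using (Subset; ∣_∣; _∈_; ⁅_⁆; inside; outside) renaming (⊥ to ∅)
open import Data.Fin.Subset.Properties using (∣⊥∣≡0; ∣⁅x⁆∣≡1; x∈⁅x⁆; x∈⁅y⁆⇒x≡y)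
import Data.List as List
open import Data.List.Membership.Propositional.Properties using (∈-lookup)
import Data.List.Relation.Unary.All as All
open import Data.List.Relation.Unary.AllPairs using (AllPairs; _∷_)
open import Data.Nat using (ℕ; zero; suc; _+_; _*_; _∸_; _≤_; _<_; z≤n; s≤s)
open import Data.Nat.Properties
  using ( ≮⇒≥; n<1+n; m<1+n⇒m<n∨m≡n; m+n≮n; +-monoʳ-≤; +-comm; <⇒≤; ≤-<-trans
        ; m∸n≤m; m<n⇒0<n∸m; m∸n+n≡m; module ≤-Reasoning)
import Data.Nat.Properties as ℕₚ
open import Data.Nat.Tactic.RingSolver using (solve-∀)
open import Data.Product using (_×_; _,_; proj₁; proj₂; ∃; ∃₂; ∃-syntax)
open import Data.Sum using (_⊎_; inj₁; inj₂; [_,_]′)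
open import Data.Vec using ([]; _∷_; lookup)
open import Data.Vec.Properties using (lookup-zipWith; lookup-replicate; zipWith-comm)
open import Data.Vec.Relation.Binary.Pointwise.Extensional using (ext; Pointwise-≡⇒≡)
open import Function using (_∘_; id)
open import Function.Bundles using (_↣_; mk↣; Injection)
open import Function.Construct.Composition using (_↣-∘_)
open import Function.Definitions using (Injective)
open import Function.Properties.Inverse using (↔⇒↣; ↔-sym)
open import Relation.Binary.Definitions using (DecidableEquality; tri<; tri≈; tri>)
open import Relation.Binary.PropositionalEquality
open import Relation.Nullary using (¬_; Dec; yes; no; does; contradiction)
open import Relation.Nullary.Decidable using (dec-true; dec-false; decidable-stable; map′)
open import Relation.Unary using (Decidable)

least : ∀ {p} (P : ℕ → Set p) → Decidable P → ∀ {n} → P n → ∃ λ k → P k × (∀ j → P j → k ≤ j)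
least P P? {n} pn = [ id , (λ none → contradiction pn (none n (n<1+n n))) ]′ (search (suc n))
  where
  search : ∀ n → (∃ λ k → P k × (∀ j → P j → k ≤ j)) ⊎ (∀ j → j < n → ¬ P j)
  search zero = inj₂ λ _ ()
  search (suc k) with search k | P? k
  ... | inj₁ found | _      = inj₁ found
  ... | inj₂ none  | yes pk = inj₁ (k , pk , λ j pj → ≮⇒≥ λ j<k → none j j<k pj)
  ... | inj₂ none  | no ¬pk = inj₂ λ j j<1+k → [ none j , (λ { refl → ¬pk }) ]′ (m<1+n⇒m<n∨m≡n j<1+k)

xor-cancelˡ : ∀ x y → x xor (x xor y) ≡ y
xor-cancelˡ x y = trans (sym (xor-assoc x x y)) (cong (_xor y) (xor-same x))

x≡x-xor-y⇒y≡false : ∀ {x y} → x ≡ x xor y → y ≡ false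
x≡x-xor-y⇒y≡false {x} {y} eq = trans (sym (xor-cancelˡ x y)) (trans (cong (x xor_) (sym eq)) (xor-same x))

module Parity {a} {A : Set a} (_≟ᴬ_ : DecidableEquality A) where

  parity : ℕ → (ℕ → A) → A → Bool
  parity zero    w x = false
  parity (suc n) w x = does (w 0 ≟ᴬ x) xor parity n (w ∘ suc) x

  EvenWord : ℕ → (ℕ → A) → Set a
  EvenWord n w = ∀ x → parity n w x ≡ false

  parity-absent : ∀ n {w x} → (∀ (j : Fin n) → w (toℕ j) ≢ x) → parity n w x ≡ false
  parity-absent zero    absent = refl
  parity-absent (suc n) {w} {x} absent =
    cong₂ _xor_ (dec-false (w 0 ≟ᴬ x) (absent zero)) (parity-absent n {w ∘ suc} (absent ∘ suc))

  parity-lone : ∀ n {w x} (i : Fin n) → w (toℕ i) ≡ x → (∀ j → j ≢ i → w (toℕ j) ≢ x) →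
                parity n w x ≡ true
  parity-lone (suc n) {w} {x} zero    wᵢ≡x others =
    cong₂ _xor_ (dec-true (w 0 ≟ᴬ x) wᵢ≡x) (parity-absent n {w ∘ suc} λ j → others (suc j) λ ())
  parity-lone (suc n) {w} {x} (suc i) wᵢ≡x others =
    cong₂ _xor_ (dec-false (w 0 ≟ᴬ x) (others zero λ ()))
                (parity-lone n {w ∘ suc} i wᵢ≡x λ j j≢i → others (suc j) (j≢i ∘ Finₚ.suc-injective))

  EvenWord⇒¬lone-letter : ∀ {n w} → EvenWord n w → (i : Fin n) →
                          ¬ (∀ j → j ≢ i → w (toℕ j) ≢ w (toℕ i))
  EvenWord⇒¬lone-letter {n} {w} even i lone
    with () ← trans (sym (parity-lone n i refl lone)) (even (w (toℕ i)))

  parity-repeat : ∀ {w x} → w 0 ≡ w 1 → parity 2 w x ≡ false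
  parity-repeat {w} {x} w₀≡w₁ =
    trans (cong (λ y → does (w 0 ≟ᴬ x) xor (does (y ≟ᴬ x) xor false)) (sym w₀≡w₁))
          (xor-cancelˡ (does (w 0 ≟ᴬ x)) false)

  parity-sandwich : ∀ {w x} → w 0 ≡ w 2 → parity 3 w x ≡ does (w 1 ≟ᴬ x)
  parity-sandwich {w} {x} w₀≡w₂ = begin
    p xor (q xor (does (w 2 ≟ᴬ x) xor false))
      ≡⟨ cong (λ y → p xor (q xor (does (y ≟ᴬ x) xor false))) (sym w₀≡w₂) ⟩
    p xor (q xor (p xor false))               ≡⟨ cong (λ y → p xor (q xor y)) (xor-identityʳ p) ⟩
    p xor (q xor p)                           ≡⟨ cong (p xor_) (xor-comm q p) ⟩
    p xor (p xor q)                           ≡⟨ xor-cancelˡ p q ⟩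
    q                                         ∎
    where
    open ≡-Reasoning
    p = does (w 0 ≟ᴬ x)
    q = does (w 1 ≟ᴬ x)

  module HexagonWord {w : ℕ → A} (even : EvenWord 6 w) (closed : w 6 ≡ w 0)
                     (consecutive-≢ : ∀ k → w k ≢ w (suc k)) where

    -- If w₅ ≡ w₁ the letter w₃ occurs only once, otherwise w₅ does.
    w₀≡w₂⇒w₃≡w₅ : w 0 ≡ w 2 → w 3 ≡ w 5
    w₀≡w₂⇒w₃≡w₅ w₀≡w₂ = decidable-stable (w 3 ≟ᴬ w 5) λ w₃≢w₅ → lone w₃≢w₅ (w 5 ≟ᴬ w 1)
      where
      lone : w 3 ≢ w 5 → Dec (w 5 ≡ w 1) → ⊥
      lone w₃≢w₅ (yes w₅≡w₁) = EvenWord⇒¬lone-letter {6} {w} even 3F λ where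
        0F _   → consecutive-≢ 2 ∘ trans (sym w₀≡w₂)
        1F _   → λ w₁≡w₃ → w₃≢w₅ (sym (trans w₅≡w₁ w₁≡w₃))
        2F _   → consecutive-≢ 2
        3F 3≢3 → contradiction refl 3≢3
        4F _   → consecutive-≢ 3 ∘ sym
        5F _   → w₃≢w₅ ∘ sym
      lone w₃≢w₅ (no w₅≢w₁) = EvenWord⇒¬lone-letter {6} {w} even 5F λ where
        0F _   → λ w₀≡w₅ → consecutive-≢ 5 (trans (sym w₀≡w₅) (sym closed))
        1F _   → w₅≢w₁ ∘ sym
        2F _   → λ w₂≡w₅ → consecutive-≢ 5 (trans (sym w₂≡w₅) (trans (sym w₀≡w₂) (sym closed)))
        3F _   → w₃≢w₅
        4F _   → consecutive-≢ 4
        5F 5≢5 → contradiction refl 5≢5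

    w≢w∘2+⇒w₀≡w₃ : (∀ k → w k ≢ w (2 + k)) → w 0 ≡ w 3
    w≢w∘2+⇒w₀≡w₃ skip-≢ = decidable-stable (w 0 ≟ᴬ w 3) λ w₀≢w₃ →
      EvenWord⇒¬lone-letter {6} {w} even 0F λ where
        0F 0≢0 → contradiction refl 0≢0
        1F _   → consecutive-≢ 0 ∘ sym
        2F _   → skip-≢ 0 ∘ sym
        3F _   → w₀≢w₃ ∘ sym
        4F _   → λ w₄≡w₀ → skip-≢ 4 (trans w₄≡w₀ (sym closed))
        5F _   → λ w₅≡w₀ → consecutive-≢ 5 (trans w₅≡w₀ (sym closed))

lookup-△ : ∀ {m} (p q : Subset m) x → lookup (p △ q) x ≡ lookup p x xor lookup q x
lookup-△ p q x = lookup-zipWith _xor_ x p q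

lookup-⁅⁆ : ∀ {m} (a x : Fin m) → lookup ⁅ a ⁆ x ≡ does (a ≟ x)
lookup-⁅⁆ zero    zero    = refl
lookup-⁅⁆ zero    (suc x) = lookup-replicate x outside
lookup-⁅⁆ (suc a) zero    = refl
lookup-⁅⁆ (suc a) (suc x) = lookup-⁅⁆ a x

△-comm : ∀ {m} (p q : Subset m) → p △ q ≡ q △ p
△-comm = zipWith-comm xor-comm

△-self : ∀ {m} (p : Subset m) → p △ p ≡ ∅
△-self []      = refl
△-self (x ∷ p) = cong₂ _∷_ (xor-same x) (△-self p)

△-pointwise : ∀ {m} {p q r : Subset m} → (∀ x → lookup q x ≡ lookup p x xor lookup r x) → p △ q ≡ r
△-pointwise {p = p} {q} {r} q≗p△r = Pointwise-≡⇒≡ (ext λ x → begin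
  lookup (p △ q) x                           ≡⟨ lookup-△ p q x ⟩
  lookup p x xor lookup q x                  ≡⟨ cong (lookup p x xor_) (q≗p△r x) ⟩
  lookup p x xor (lookup p x xor lookup r x) ≡⟨ xor-cancelˡ (lookup p x) (lookup r x) ⟩
  lookup r x                                 ∎)
  where open ≡-Reasoning

△-pointwise⁻¹ : ∀ {m} {p q r : Subset m} → p △ q ≡ r → ∀ x → lookup q x ≡ lookup p x xor lookup r x
△-pointwise⁻¹ {p = p} {q} {r} p△q≡r x = begin
  lookup q x                                 ≡⟨ sym (xor-cancelˡ (lookup p x) (lookup q x)) ⟩
  lookup p x xor (lookup p x xor lookup q x) ≡⟨ cong (lookup p x xor_) (sym (lookup-△ p q x)) ⟩
  lookup p x xor lookup (p △ q) x            ≡⟨ cong (λ s → lookup p x xor lookup s x) p△q≡r ⟩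
  lookup p x xor lookup r x                  ∎
  where open ≡-Reasoning

∣p∣≡0⇒p≡∅ : ∀ {m} (p : Subset m) → ∣ p ∣ ≡ 0 → p ≡ ∅
∣p∣≡0⇒p≡∅ []            _     = refl
∣p∣≡0⇒p≡∅ (inside  ∷ p) ()
∣p∣≡0⇒p≡∅ (outside ∷ p) ∣p∣≡0 = cong (outside ∷_) (∣p∣≡0⇒p≡∅ p ∣p∣≡0)

∣p∣≡1⇒p≡⁅x⁆ : ∀ {m} (p : Subset m) → ∣ p ∣ ≡ 1 → ∃ λ a → p ≡ ⁅ a ⁆
∣p∣≡1⇒p≡⁅x⁆ (inside  ∷ p) ∣p∣≡1 = zero , cong (inside ∷_) (∣p∣≡0⇒p≡∅ p (ℕₚ.suc-injective ∣p∣≡1))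
∣p∣≡1⇒p≡⁅x⁆ (outside ∷ p) ∣p∣≡1 with ∣p∣≡1⇒p≡⁅x⁆ p ∣p∣≡1
... | a , p≡⁅a⁆ = suc a , cong (outside ∷_) p≡⁅a⁆

⁅⁆-injective : ∀ {m} {a b : Fin m} → ⁅ a ⁆ ≡ ⁅ b ⁆ → a ≡ b
⁅⁆-injective {a = a} {b} eq = x∈⁅y⁆⇒x≡y b (subst (a ∈_) eq (x∈⁅x⁆ a))

allPairs-lookup : ∀ {a r} {A : Set a} {R : A → A → Set r} {xs : List.List A} → AllPairs R xs →
                  ∀ {i j} → i <ᶠ j → R (List.lookup xs i) (List.lookup xs j)
allPairs-lookup (x∼xs ∷ _)  {zero}  {suc j} _         = All.lookup x∼xs (∈-lookup j)
allPairs-lookup (_ ∷ xs∼xs) {suc i} {suc j} (s≤s i<j) = allPairs-lookup xs∼xs i<j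

Fin×Fin↣⇒*≤ : ∀ {a b c d} → (Fin a × Fin b) ↣ (Fin c × Fin d) → a * b ≤ c * d
Fin×Fin↣⇒*≤ f =
  Finₚ.injective⇒≤ (Injection.injective (↔⇒↣ (↔-sym Finₚ.*↔×) ↣-∘ (f ↣-∘ ↔⇒↣ Finₚ.*↔×)))

euler-excludes-hexagons : ∀ V F → 2 * (V + F) ≡ 4 + 3 * V → ¬ (F * 6 ≤ V * 3)
euler-excludes-hexagons V F euler 6F≤3V = m+n≮n 11 (9 * V) (begin
  12 + 9 * V            ≡⟨ 12+9V≡3[4+3V] V ⟩
  3 * (4 + 3 * V)       ≡⟨ cong (3 *_) euler ⟨
  3 * (2 * (V + F))     ≡⟨ 3[2[V+F]]≡6V+6F V F ⟩
  6 * V + F * 6         ≤⟨ +-monoʳ-≤ (6 * V) 6F≤3V ⟩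
  6 * V + V * 3         ≡⟨ 6V+3V≡9V V ⟩
  9 * V                 ∎)
  where
  open ≤-Reasoning
  12+9V≡3[4+3V] : ∀ V → 12 + 9 * V ≡ 3 * (4 + 3 * V)
  12+9V≡3[4+3V] = solve-∀
  3[2[V+F]]≡6V+6F : ∀ V F → 3 * (2 * (V + F)) ≡ 6 * V + F * 6
  3[2[V+F]]≡6V+6F = solve-∀
  6V+3V≡9V : ∀ V → 6 * V + V * 3 ≡ 9 * V
  6V+3V≡9V = solve-∀

next3≢id : ∀ i → next3 i ≢ i
next3≢id 0F ()
next3≢id 1F ()
next3≢id 2F ()

next3³≡id : ∀ i → next3 (next3 (next3 i)) ≡ i
next3³≡id 0F = refl
next3³≡id 1F = refl
next3³≡id 2F = refl

next3-orbit : ∀ i j → j ≡ i ⊎ j ≡ next3 i ⊎ j ≡ next3 (next3 i)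
next3-orbit 0F 0F = inj₁ refl
next3-orbit 0F 1F = inj₂ (inj₁ refl)
next3-orbit 0F 2F = inj₂ (inj₂ refl)
next3-orbit 1F 0F = inj₂ (inj₂ refl)
next3-orbit 1F 1F = inj₁ refl
next3-orbit 1F 2F = inj₂ (inj₁ refl)
next3-orbit 2F 0F = inj₂ (inj₁ refl)
next3-orbit 2F 1F = inj₂ (inj₂ refl)
next3-orbit 2F 2F = inj₁ refl

module CubicMapProperties {V : ℕ} (G : CubicMap V) where
  open CubicMap G

  private
    fs : Dart V → Dart V
    fs = faceStep G

    fs^ : ℕ → Dart V → Dart V
    fs^ = faceStep^ G

  rot : Dart V → Dart V
  rot (v , i) = v , next3 i

  rot³≡id : ∀ d → rot (rot (rot d)) ≡ d
  rot³≡id (v , i) = cong (v ,_) (next3³≡id i)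

  darts-at-vertex : ∀ {d d′} → tail G d′ ≡ tail G d → d′ ≡ d ⊎ d′ ≡ rot d ⊎ d′ ≡ rot (rot d)
  darts-at-vertex {v , i} {.v , j} refl with next3-orbit i j
  ... | inj₁ refl        = inj₁ refl
  ... | inj₂ (inj₁ refl) = inj₂ (inj₁ refl)
  ... | inj₂ (inj₂ refl) = inj₂ (inj₂ refl)

  third-dart : ∀ {d d′} → tail G d′ ≡ tail G d →
               head G d′ ≢ head G d → head G d′ ≢ head G (rot (rot d)) → d′ ≡ rot d
  third-dart same-tail ≢head ≢head-rot² with darts-at-vertex same-tail
  ... | inj₁ d′≡d           = contradiction (cong (head G) d′≡d) ≢head
  ... | inj₂ (inj₁ d′≡rot)   = d′≡rot
  ... | inj₂ (inj₂ d′≡rot²)  = contradiction (cong (head G) d′≡rot²) ≢head-rot²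

  head-rev : ∀ d → head G (rev d) ≡ tail G d
  head-rev d = cong proj₁ (rev-inv d)

  faceStep-rev : ∀ d → fs (rev d) ≡ rot d
  faceStep-rev d = cong rot (rev-inv d)

  rot²∘faceStep : ∀ d → rot (rot (fs d)) ≡ rev d
  rot²∘faceStep d = rot³≡id (rev d)

  faceStep-injective : ∀ {d e} → fs d ≡ fs e → d ≡ e
  faceStep-injective {d} {e} eq = begin
    d                      ≡⟨ rev-inv d ⟨
    rev (rev d)            ≡⟨ cong rev (rot²∘faceStep d) ⟨
    rev (rot (rot (fs d))) ≡⟨ cong (rev ∘ rot ∘ rot) eq ⟩
    rev (rot (rot (fs e))) ≡⟨ cong rev (rot²∘faceStep e) ⟩
    rev (rev e)            ≡⟨ rev-inv e ⟩
    e                      ∎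
    where open ≡-Reasoning

  faceStep^-injective : ∀ k {d e} → fs^ k d ≡ fs^ k e → d ≡ e
  faceStep^-injective zero    eq = eq
  faceStep^-injective (suc k) eq = faceStep^-injective k (faceStep-injective eq)

  faceStep^-+ : ∀ j k d → fs^ (j + k) d ≡ fs^ j (fs^ k d)
  faceStep^-+ zero    k d = refl
  faceStep^-+ (suc j) k d = cong fs (faceStep^-+ j k d)

  faceStep^-comm : ∀ j k d → fs^ j (fs^ k d) ≡ fs^ k (fs^ j d)
  faceStep^-comm j k d = begin
    fs^ j (fs^ k d) ≡⟨ faceStep^-+ j k d ⟨
    fs^ (j + k) d   ≡⟨ cong (λ n → fs^ n d) (+-comm j k) ⟩
    fs^ (k + j) d   ≡⟨ faceStep^-+ k j d ⟩
    fs^ k (fs^ j d) ∎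
    where open ≡-Reasoning

  FaceSize-faceStep^ : ∀ {d n} → FaceSize G d n → ∀ k → FaceSize G (fs^ k d) n
  FaceSize-faceStep^ {d} {n} (cycle , minimal) k =
      trans (faceStep^-comm n k d) (cong (fs^ k) cycle)
    , λ j 1≤j j<n eq → minimal j 1≤j j<n (faceStep^-injective k (trans (faceStep^-comm k j d) eq))

  orbit-distinct : ∀ {d n a b} → FaceSize G d n → a < b → b < n → fs^ a d ≢ fs^ b d
  orbit-distinct {d} {n} {a} {b} (_ , minimal) a<b b<n eq =
    minimal (b ∸ a) (m<n⇒0<n∸m a<b) (≤-<-trans (m∸n≤m b a) b<n) (sym (faceStep^-injective a (begin
      fs^ a d               ≡⟨ eq ⟩
      fs^ b d               ≡⟨ cong (λ k → fs^ k d) (m∸n+n≡m (<⇒≤ a<b)) ⟨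
      fs^ (b ∸ a + a) d     ≡⟨ faceStep^-+ (b ∸ a) a d ⟩
      fs^ (b ∸ a) (fs^ a d) ≡⟨ faceStep^-comm (b ∸ a) a d ⟩
      fs^ a (fs^ (b ∸ a) d) ∎)))
    where open ≡-Reasoning

  orbit-injective : ∀ {d n a b} → FaceSize G d n → a < n → b < n → fs^ a d ≡ fs^ b d → a ≡ b
  orbit-injective {a = a} {b} size a<n b<n eq with ℕₚ.<-cmp a b
  ... | tri< a<b _ _ = contradiction eq (orbit-distinct size a<b b<n)
  ... | tri≈ _ a≡b _ = a≡b
  ... | tri> _ _ b<a = contradiction (sym eq) (orbit-distinct size b<a a<n)

  same-face : ∀ {x y n a b} → FaceSize G y n → b ≤ n → fs^ a x ≡ fs^ b y → SameFace G x y
  same-face {x} {y} {n} {a} {b} (cycle , _) b≤n eq = n ∸ b + a , (begin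
    fs^ (n ∸ b + a) x     ≡⟨ faceStep^-+ (n ∸ b) a x ⟩
    fs^ (n ∸ b) (fs^ a x) ≡⟨ cong (fs^ (n ∸ b)) eq ⟩
    fs^ (n ∸ b) (fs^ b y) ≡⟨ faceStep^-+ (n ∸ b) b y ⟨
    fs^ (n ∸ b + b) y     ≡⟨ cong (λ k → fs^ k y) (m∸n+n≡m b≤n) ⟩
    fs^ n y               ≡⟨ cycle ⟩
    y                     ∎)
    where open ≡-Reasoning

  plane-not-all-hexagons : Plane G → ¬ (∀ d → FaceSize G d 6)
  plane-not-all-hexagons (R , distinct , _ , euler) hexagon =
    euler-excludes-hexagons V (List.length R) euler (Fin×Fin↣⇒*≤ (mk↣ dart-injective))
    where
    dart : Fin (List.length R) × Fin 6 → Dart V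
    dart (r , k) = fs^ (toℕ k) (List.lookup R r)

    dart-injective : Injective _≡_ _≡_ dart
    dart-injective {r , k} {r′ , k′} eq with Finₚ.<-cmp r r′
    ... | tri< r<r′ _ _ =
      contradiction (same-face (hexagon _) (<⇒≤ (Finₚ.toℕ<n k′)) eq) (allPairs-lookup distinct r<r′)
    ... | tri≈ _ refl _ =
      cong (r ,_) (Finₚ.toℕ-injective (orbit-injective (hexagon _) (Finₚ.toℕ<n k) (Finₚ.toℕ<n k′) eq))
    ... | tri> _ _ r′<r =
      contradiction (same-face (hexagon _) (<⇒≤ (Finₚ.toℕ<n k)) (sym eq)) (allPairs-lookup distinct r′<r)

  walk-length-0 : ∀ {u w} → Walk G u w 0 → u ≡ w
  walk-length-0 nil = refl

  walk-length-1 : ∀ {u w} → Walk G u w 1 → ∃ λ i → head G (u , i) ≡ w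
  walk-length-1 (step i nil) = i , refl

  walk? : ∀ n u w → Dec (Walk G u w n)
  walk? zero    u w = map′ (λ { refl → nil }) walk-length-0 (u ≟ w)
  walk? (suc n) u w = map′ (λ (i , walk) → step i walk) (λ { (step i walk) → i , walk })
                           (Finₚ.any? λ i → walk? n (head G (u , i)) w)

  distance : Connected G → ∀ u w → ∃ (IsDist G u w)
  distance connected u w = least (λ n → Walk G u w n) (λ n → walk? n u w) (proj₂ (connected u w))

  walk-preserves : ∀ {p} (P : Fin V → Set p) → (∀ {v} i → P v → P (head G (v , i))) →
                   ∀ {u w n} → Walk G u w n → P u → P w
  walk-preserves P step-preserves nil           pu = pu
  walk-preserves P step-preserves (step i walk) pu =
    walk-preserves P step-preserves walk (step-preserves i pu)

  module _ (simple : Simple G) where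

    head-rot≢head : ∀ d → head G (rot d) ≢ head G d
    head-rot≢head (v , i) eq = next3≢id i (proj₂ simple v (next3 i) i eq)

    no-backtracking : ∀ d → head G (fs d) ≢ tail G d
    no-backtracking d eq = head-rot≢head (rev d) (trans eq (sym (head-rev d)))

    edge-distance : ∀ d → IsDist G (tail G d) (head G d) 1
    edge-distance d = step (proj₂ d) nil , λ where
      zero    walk → contradiction (walk-length-0 walk) (proj₁ simple d ∘ sym)
      (suc _) _    → s≤s z≤n

module Embedding {V : ℕ} (G : CubicMap V) (simple : Simple G) (connected : Connected G)
                 {m : ℕ} (φ : Fin V → Subset m) (iso : IsometricEmbedding G m φ) where
  open CubicMap G
  open CubicMapProperties G
  open Parity (_≟_ {m})

  private
    fs : Dart V → Dart V
    fs = faceStep G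

    fs^ : ℕ → Dart V → Dart V
    fs^ = faceStep^ G

  χ : Fin V → Fin m → Bool
  χ v = lookup (φ v)

  walk-of-length-∣△∣ : ∀ u w → Walk G u w ∣ φ u △ φ w ∣
  walk-of-length-∣△∣ u w with distance connected u w
  ... | n , dist = subst (Walk G u w) (sym (iso u w n dist)) (proj₁ dist)

  χ-injective : ∀ {u w} → χ u ≗ χ w → u ≡ w
  χ-injective {u} {w} χu≗χw =
    walk-length-0 (subst (Walk G u w) ∣φu△φw∣≡0 (walk-of-length-∣△∣ u w))
    where
    open ≡-Reasoning
    ∣φu△φw∣≡0 : ∣ φ u △ φ w ∣ ≡ 0
    ∣φu△φw∣≡0 = begin
      ∣ φ u △ φ w ∣ ≡⟨ cong (λ p → ∣ φ u △ p ∣) (Pointwise-≡⇒≡ (ext χu≗χw)) ⟨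
      ∣ φ u △ φ u ∣ ≡⟨ trans (cong ∣_∣ (△-self (φ u))) (∣⊥∣≡0 m) ⟩
      0             ∎

  χ-adjacent : ∀ {u w a} → (∀ x → χ w x ≡ χ u x xor does (a ≟ x)) → ∃ λ i → head G (u , i) ≡ w
  χ-adjacent {u} {w} {a} χw≗χu⊕a =
    walk-length-1 (subst (Walk G u w) ∣φu△φw∣≡1 (walk-of-length-∣△∣ u w))
    where
    φu△φw≡⁅a⁆ : φ u △ φ w ≡ ⁅ a ⁆
    φu△φw≡⁅a⁆ = △-pointwise λ x → trans (χw≗χu⊕a x) (cong (χ u x xor_) (sym (lookup-⁅⁆ a x)))

    ∣φu△φw∣≡1 : ∣ φ u △ φ w ∣ ≡ 1
    ∣φu△φw∣≡1 = trans (cong ∣_∣ φu△φw≡⁅a⁆) (∣⁅x⁆∣≡1 a)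

  label-singleton : ∀ d → ∃ λ a → φ (tail G d) △ φ (head G d) ≡ ⁅ a ⁆
  label-singleton d = ∣p∣≡1⇒p≡⁅x⁆ _ (iso _ _ 1 (edge-distance simple d))

  label : Dart V → Fin m
  label d = proj₁ (label-singleton d)

  label-spec : ∀ d → φ (tail G d) △ φ (head G d) ≡ ⁅ label d ⁆
  label-spec d = proj₂ (label-singleton d)

  Label-label : ∀ d → Label G φ d (label d)
  Label-label d = subst (label d ∈_) (sym (label-spec d)) (x∈⁅x⁆ (label d))

  label-rev : ∀ d → label (rev d) ≡ label d
  label-rev d = ⁅⁆-injective (begin
    ⁅ label (rev d) ⁆                  ≡⟨ label-spec (rev d) ⟨
    φ (head G d) △ φ (head G (rev d))  ≡⟨ cong (λ v → φ (head G d) △ φ v) (head-rev d) ⟩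
    φ (head G d) △ φ (tail G d)        ≡⟨ △-comm (φ (head G d)) (φ (tail G d)) ⟩
    φ (tail G d) △ φ (head G d)        ≡⟨ label-spec d ⟩
    ⁅ label d ⁆                        ∎)
    where open ≡-Reasoning

  χ-head : ∀ d x → χ (head G d) x ≡ χ (tail G d) x xor does (label d ≟ x)
  χ-head d x = trans (△-pointwise⁻¹ (label-spec d) x) (cong (χ (tail G d) x xor_) (lookup-⁅⁆ (label d) x))

  Trail : (ℕ → Dart V) → Set
  Trail δ = ∀ k → tail G (δ (suc k)) ≡ head G (δ k)

  χ-trail : ∀ {δ} → Trail δ → ∀ n x → χ (tail G (δ n)) x ≡ χ (tail G (δ 0)) x xor parity n (label ∘ δ) x
  χ-trail         trail zero    x = sym (xor-identityʳ _)
  χ-trail {δ} trail (suc n) x = begin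
    χ (tail G (δ (suc n))) x                 ≡⟨ χ-trail {δ ∘ suc} (trail ∘ suc) n x ⟩
    χ (tail G (δ 1)) x xor rest              ≡⟨ cong (_xor rest) first-step ⟩
    (χ₀ xor does (label (δ 0) ≟ x)) xor rest ≡⟨ xor-assoc χ₀ (does (label (δ 0) ≟ x)) rest ⟩
    χ₀ xor parity (suc n) (label ∘ δ) x      ∎
    where
    open ≡-Reasoning
    χ₀ = χ (tail G (δ 0)) x
    rest = parity n (label ∘ δ ∘ suc) x

    first-step : χ (tail G (δ 1)) x ≡ χ₀ xor does (label (δ 0) ≟ x)
    first-step = trans (cong (λ v → χ v x) (trail 0)) (χ-head (δ 0) x)

  labels : Dart V → ℕ → Fin m
  labels d k = label (fs^ k d)

  χ-face : ∀ d n x → χ (tail G (fs^ n d)) x ≡ χ (tail G d) x xor parity n (labels d) x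
  χ-face d = χ-trail {λ k → fs^ k d} (λ _ → refl)

  face-even : ∀ {d n} → fs^ n d ≡ d → EvenWord n (labels d)
  face-even {d} {n} cycle x =
    x≡x-xor-y⇒y≡false (trans (cong (λ e → χ (tail G e) x) (sym cycle)) (χ-face d n x))

  label-≢-next : ∀ d → label d ≢ label (fs d)
  label-≢-next d repeat = no-backtracking simple d (χ-injective λ x → begin
    χ (tail G (fs^ 2 d)) x                   ≡⟨ χ-face d 2 x ⟩
    χ (tail G d) x xor parity 2 (labels d) x ≡⟨ cong (χ (tail G d) x xor_) (parity-repeat {labels d} repeat) ⟩
    χ (tail G d) x xor false                 ≡⟨ xor-identityʳ _ ⟩
    χ (tail G d) x                           ∎)
    where open ≡-Reasoning

  Degenerate : Dart V → Set
  Degenerate e = FaceSize G e 6 × label e ≡ label (fs^ 2 e)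

  module HexagonFace {d} (hexagon : FaceSize G d 6) =
    HexagonWord {labels d} (face-even (proj₁ hexagon)) (cong label (proj₁ hexagon))
                (λ k → label-≢-next (fs^ k d))

  hexagon-rot² : ∀ {d} → fs^ 6 d ≡ d → rot (rot d) ≡ rev (fs^ 5 d)
  hexagon-rot² {d} cycle = trans (cong (rot ∘ rot) (sym cycle)) (rot²∘faceStep (fs^ 5 d))

  module _ (faces : ∀ d → FaceSize G d 4 ⊎ FaceSize G d 6) where

    module _ {e} (degenerate : Degenerate e) where
      private
        hexagon = proj₁ degenerate
        cycle = proj₁ hexagon

        v : ℕ → Fin V
        v k = tail G (fs^ k e)

        v≢v∘2+ : ∀ k → v (2 + k) ≢ v k
        v≢v∘2+ k = no-backtracking simple (fs^ k e)

        head-rot² : head G (rot (rot e)) ≡ v 5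
        head-rot² = trans (cong (head G) (hexagon-rot² cycle)) (head-rev (fs^ 5 e))

        head-rot²-fs³ : head G (rot (rot (fs^ 3 e))) ≡ v 2
        head-rot²-fs³ = trans (cong (head G) (rot²∘faceStep (fs^ 2 e))) (head-rev (fs^ 2 e))

        head-rev-rot : head G (rev (rot e)) ≡ v 0
        head-rev-rot = head-rev (rot e)

      chord : head G (rot e) ≡ v 3
      chord with χ-adjacent {v 0} {v 3} {label (fs e)} (λ x →
                   trans (χ-face e 3 x) (cong (χ (v 0) x xor_) (parity-sandwich {labels e} (proj₂ degenerate))))
      ... | i , head≡v₃ = trans (cong (head G) (sym chord-dart)) head≡v₃
        where
        chord-dart : (v 0 , i) ≡ rot e
        chord-dart = third-dart refl (subst₂ _≢_ (sym head≡v₃) refl (v≢v∘2+ 1))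
                                     (subst₂ _≢_ (sym head≡v₃) (sym head-rot²) (≢-sym (v≢v∘2+ 3)))

      rev-chord : rev (rot e) ≡ rot (fs^ 3 e)
      rev-chord = third-dart chord
        (subst₂ _≢_ (trans (cong (tail G) cycle) (sym head-rev-rot)) refl (v≢v∘2+ 4))
        (subst₂ _≢_ (sym head-rev-rot) (sym head-rot²-fs³) (≢-sym (v≢v∘2+ 0)))

      across : fs^ 2 (rev e) ≡ rev (fs^ 2 e)
      across = begin
        fs (fs (rev e))      ≡⟨ cong fs (faceStep-rev e) ⟩
        fs (rot e)           ≡⟨ cong rot rev-chord ⟩
        rot (rot (fs^ 3 e))  ≡⟨ rot²∘faceStep (fs^ 2 e) ⟩
        rev (fs^ 2 e)        ∎
        where open ≡-Reasoning

      -- Were the face of rev e a square, v₂ would have two edges to v₁.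
      rev-not-square : fs^ 4 (rev e) ≢ rev e
      rev-not-square square = head-rot≢head simple (rot (fs^ 2 e)) (begin
        head G (rot (rot (fs^ 2 e)))          ≡⟨ cong (head G) (rot²∘faceStep (fs e)) ⟩
        head G (rev (fs e))                   ≡⟨ head-rev (fs e) ⟩
        tail G (rev e)                        ≡⟨ cong (tail G) square ⟨
        tail G (fs (fs (fs^ 2 (rev e))))      ≡⟨ cong (tail G ∘ fs ∘ fs) across ⟩
        tail G (fs (fs (rev (fs^ 2 e))))      ≡⟨ cong (tail G ∘ fs) (faceStep-rev (fs^ 2 e)) ⟩
        head G (rot (fs^ 2 e))                ∎)
        where open ≡-Reasoning

      degenerate-rev : Degenerate (rev e)
      degenerate-rev =
        [ (λ square → contradiction (proj₁ square) rev-not-square) , id ]′ (faces (rev e)) , (begin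
        label (rev e)          ≡⟨ label-rev e ⟩
        label e                ≡⟨ proj₂ degenerate ⟩
        label (fs^ 2 e)        ≡⟨ label-rev (fs^ 2 e) ⟨
        label (rev (fs^ 2 e))  ≡⟨ cong label across ⟨
        label (fs^ 2 (rev e))  ∎)
        where open ≡-Reasoning

      degenerate-fs³ : Degenerate (fs^ 3 e)
      degenerate-fs³ = FaceSize-faceStep^ hexagon 3 , HexagonFace.w₀≡w₂⇒w₃≡w₅ hexagon (proj₂ degenerate)

    DegenerateVertex : Fin V → Set
    DegenerateVertex w = ∃ λ e → Degenerate e × tail G e ≡ w

    OnDegenerateFace : Dart V → Set
    OnDegenerateFace d = ∃₂ λ e k → Degenerate e × fs^ k e ≡ d

    degenerate-face-vertices : ∀ {e} → Degenerate e → ∀ k → DegenerateVertex (tail G (fs^ k e))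
    degenerate-face-vertices deg 0 = _ , deg , refl
    degenerate-face-vertices deg 1 = _ , degenerate-rev deg , refl
    degenerate-face-vertices deg 2 =
      _ , degenerate-fs³ (degenerate-rev deg) , trans (cong (head G) (across deg)) (head-rev _)
    degenerate-face-vertices {e} deg (suc (suc (suc k))) =
      subst (DegenerateVertex ∘ tail G) three-later (degenerate-face-vertices (degenerate-fs³ deg) k)
      where
      three-later : fs^ k (fs^ 3 e) ≡ fs^ (3 + k) e
      three-later = trans (sym (faceStep^-+ k 3 e)) (cong (λ n → fs^ n e) (+-comm k 3))

    degenerate-vertex-darts : ∀ {d} → DegenerateVertex (tail G d) → OnDegenerateFace d
    degenerate-vertex-darts {d} (e , deg , e-at-d) with darts-at-vertex {e} {d} (sym e-at-d)
    ... | inj₁ d≡e          = e , 0 , deg , sym d≡e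
    ... | inj₂ (inj₁ d≡rot)  = rev e , 1 , degenerate-rev deg , trans (faceStep-rev e) (sym d≡rot)
    ... | inj₂ (inj₂ d≡rot²) = rev (fs^ 3 e) , 2 , degenerate-rev (degenerate-fs³ deg) , (begin
      fs^ 2 (rev (fs^ 3 e)) ≡⟨ across (degenerate-fs³ deg) ⟩
      rev (fs^ 5 e)         ≡⟨ hexagon-rot² (proj₁ (proj₁ deg)) ⟨
      rot (rot e)           ≡⟨ d≡rot² ⟨
      d                     ∎)
      where open ≡-Reasoning

    degenerate-everywhere : ∀ {e} → Degenerate e → ∀ w → DegenerateVertex w
    degenerate-everywhere {e} deg w =
      walk-preserves DegenerateVertex adjacent (proj₂ (connected (tail G e) w)) (e , deg , refl)
      where
      adjacent : ∀ {v} i → DegenerateVertex v → DegenerateVertex (head G (v , i))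
      adjacent {v} i dv with degenerate-vertex-darts {v , i} dv
      ... | e′ , k , deg′ , on-face =
        subst (DegenerateVertex ∘ head G) on-face (degenerate-face-vertices deg′ (suc k))

    no-degenerate-hexagon : Plane G → ∀ e → ¬ Degenerate e
    no-degenerate-hexagon plane e deg =
      plane-not-all-hexagons plane λ d →
        on-face-hexagon (degenerate-vertex-darts (degenerate-everywhere deg (tail G d)))
      where
      on-face-hexagon : ∀ {d} → OnDegenerateFace d → FaceSize G d 6
      on-face-hexagon (e′ , k , deg′ , on-face) =
        subst (λ d → FaceSize G d 6) on-face (FaceSize-faceStep^ (proj₁ deg′) k)

    opposite-labels : Plane G → ∀ {d} → FaceSize G d 6 → label d ≡ label (fs^ 3 d)
    opposite-labels plane {d} hexagon = HexagonFace.w≢w∘2+⇒w₀≡w₃ hexagon λ k repeat →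
      no-degenerate-hexagon plane (fs^ k d) (FaceSize-faceStep^ hexagon k , repeat)

corollary7 : (V : ℕ) (G : CubicMap V) → Simple G → Connected G → Plane G
    → (∀ d → FaceSize G d 4 ⊎ FaceSize G d 6)
    → (m : ℕ) (φ : Fin V → Subset m) → IsometricEmbedding G m φ
    → ∀ d → FaceSize G d 6
    → ∃[ a ] ∃[ b ] ∃[ c ] ((a ≢ b) × (b ≢ c) × (a ≢ c)
        × Label G φ d a × Label G φ (faceStep^ G 1 d) b × Label G φ (faceStep^ G 2 d) c
        × Label G φ (faceStep^ G 3 d) a × Label G φ (faceStep^ G 4 d) b × Label G φ (faceStep^ G 5 d) c)
corollary7 V G simple connected plane faces m φ iso d hexagon =
    labels d 0 , labels d 1 , labels d 2
  , label-≢-next d , label-≢-next (faceStep G d)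
  , (λ repeat → no-degenerate-hexagon faces plane d (hexagon , repeat))
  , Label-label _ , Label-label _ , Label-label _
  , opposite 0 , opposite 1 , opposite 2
  where
  open CubicMapProperties G using (FaceSize-faceStep^)
  open Embedding G simple connected φ iso

  opposite : ∀ k → Label G φ (faceStep^ G (3 + k) d) (labels d k)
  opposite k =
    subst (Label G φ _) (sym (opposite-labels faces plane (FaceSize-faceStep^ hexagon k))) (Label-label _)
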